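{- For every $G\in\mathbb{Np}^\infty$: $G\succcurlyeq 0$ if and only if $o(G)\in\{\mathscr L,\mathscr P\}$, where $0=\{\overline\infty\mid\infty\}$.
   Context: Affine normal play forms $\mathbb{Np}^\infty$ are defined recursively: two atomic forms $\infty$ and $\overline{\infty}$ with no options; every other form is $G=\{G^{\mathcal L}\mid G^{\mathcal R}\}$ with finite nonempty sets of previously constructed forms as Left and Right options. Disjunctive sum: $\infty+X=X+\infty=\infty$ for $X\neq\overline{\infty}$; $\overline{\infty}+X=X+\overline{\infty}=\overline{\infty}$ for $X\ne\infty$; $\infty+\overline{\infty}$ undefined; otherwise $G+H=\{G^L+H,G+H^L\mid G^R+H,G+H^R\}$. Outcomes: Left wins $\infty$ and Right wins $\overline{\infty}$ whoever moves; otherwise play alternates, Left moving first wins iff some Left option is won by Left moving second, Left moving second wins iff every Right option is won by Left moving first, symmetrically for Right. $o(G)$ is $\mathscr L$ (Left wins moving first and second), $\mathscr R$ (Right wins either way), $\mathscr N$ (first player wins), $\mathscr P$ (second player wins), partially ordered by $\mathscr L>\mathscr N>\mathscr R$, $\mathscr L>\mathscr P>\mathscr R$, with $\mathscr N,\mathscr P$ incomparable. $G\succcurlyeq H$ means $o(G+X)\geqslant o(H+X)$ for every $X\in\mathbb{Np}^\infty\setminus\{\infty,\overline\infty\}$. -}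

module Defs where

open import Data.Nat using (ℕ; zero; suc; _+_)
open import Data.Fin using (Fin; zero; suc; splitAt)
open import Data.Bool using (Bool; true; false; _∨_; _∧_; not)
open import Data.Sum using (inj₁; inj₂)

-- Affine normal play forms.  A non-atomic form has a nonempty finite family
-- of Left options (indexed by Fin (suc m)) and of Right options (Fin (suc n)).
data Form : Set where
  ∞    : Form
  ∞bar : Form
  node : (m : ℕ) → (Fin (suc m) → Form) → (n : ℕ) → (Fin (suc n) → Form) → Form

join : ∀ {m n} {A : Set} → (Fin (suc m) → A) → (Fin (suc n) → A) → Fin (suc m + suc n) → A
join {m} f g i with splitAt (suc m) i
... | inj₁ j = f j
... | inj₂ j = g j

-- Disjunctive sum.  The case ∞ + ∞bar is undefined in the paper; here it is
-- given the arbitrary value ∞ (it never arises in sums G + X with X non-atomic).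
_⊕_ : Form → Form → Form
∞ ⊕ _ = ∞
∞bar ⊕ ∞ = ∞
∞bar ⊕ _ = ∞bar
node _ _ _ _ ⊕ ∞ = ∞
node _ _ _ _ ⊕ ∞bar = ∞bar
G@(node a f b h) ⊕ X@(node c k d l) =
  node (a + suc c) (join (λ i → f i ⊕ X) (λ j → G ⊕ k j))
       (b + suc d) (join (λ i → h i ⊕ X) (λ j → G ⊕ l j))

anyF : ∀ {n} → (Fin n → Bool) → Bool
anyF {zero} _ = false
anyF {suc n} p = p zero ∨ anyF (λ i → p (suc i))

allF : ∀ {n} → (Fin n → Bool) → Bool
allF {zero} _ = true
allF {suc n} p = p zero ∧ allF (λ i → p (suc i))

-- Winning predicates: Left moving first / second, Right moving first / second.
leftFirst leftSecond rightFirst rightSecond : Form → Bool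
leftFirst ∞ = true
leftFirst ∞bar = false
leftFirst (node _ f _ _) = anyF (λ i → leftSecond (f i))
leftSecond ∞ = true
leftSecond ∞bar = false
leftSecond (node _ _ _ h) = allF (λ j → leftFirst (h j))
rightFirst ∞ = false
rightFirst ∞bar = true
rightFirst (node _ _ _ h) = anyF (λ j → rightSecond (h j))
rightSecond ∞ = false
rightSecond ∞bar = true
rightSecond (node _ f _ _) = allF (λ i → rightFirst (f i))

data Outcome : Set where
  𝓛 𝓝 𝓟 𝓡 : Outcome

-- o(G).  𝓛: Left wins first and second; 𝓡: Right wins first and second;
-- 𝓝: first player wins; 𝓟: second player wins.
-- (By determinacy, Right wins moving second iff Left does not win moving
-- first, and symmetrically, so these four cases are exhaustive.)
o : Form → Outcome
o G with leftFirst G | leftSecond G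
... | true  | true  = 𝓛
... | true  | false = 𝓝
... | false | true  = 𝓟
... | false | false = 𝓡

data _≥ₒ_ : Outcome → Outcome → Set where
  refl≥ : ∀ {x} → x ≥ₒ x
  L≥N : 𝓛 ≥ₒ 𝓝
  L≥P : 𝓛 ≥ₒ 𝓟
  L≥R : 𝓛 ≥ₒ 𝓡
  N≥R : 𝓝 ≥ₒ 𝓡
  P≥R : 𝓟 ≥ₒ 𝓡

_≽_ : Form → Form → Set
G ≽ H = ∀ m (f : Fin (suc m) → Form) n (h : Fin (suc n) → Form) →
        o (G ⊕ node m f n h) ≥ₒ o (H ⊕ node m f n h)

zeroF : Form
zeroF = node 0 (λ _ → ∞bar) 0 (λ _ → ∞)

{-# OPTIONS --safe #-}
-- Both directions reduce to the statement "Left wins G moving second".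
-- If she does, then in G + X she answers every move of Right in the component
-- it was made in, so she wins G + X in every role in which she wins X; and
-- she wins X whenever she wins 0 + X, since in 0 + X her only extra move is to
-- ∞bar and Right's only extra move is to ∞.  Conversely, taking X = 0 gives
-- o(G + 0) ≥ o(0 + 0) = 𝓟, and Left winning G + 0 moving second yields her
-- winning G moving second by the same observation about the moves in 0.
module Submission where

open import Defs
open import Data.Sum using (_⊎_)
open import Data.Product using (_×_)
open import Relation.Binary.PropositionalEquality using (_≡_)

open import Data.Nat using (ℕ; zero; suc)
open import Data.Fin using (Fin; zero; suc; splitAt; _↑ˡ_; _↑ʳ_)
open import Data.Fin.Properties using (splitAt-↑ˡ; splitAt-↑ʳ)
open import Data.Bool using (Bool; true; false; _∨_)
open import Data.Bool.Properties using (∨-zeroʳ)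
open import Data.Sum using (inj₁; inj₂)
open import Data.Product using (∃; _,_)
open import Function using (_∘_; case_of_)
open import Relation.Binary.PropositionalEquality using (refl; sym; trans; cong)

anyF⁺ : ∀ {n} (p : Fin n → Bool) i → p i ≡ true → anyF p ≡ true
anyF⁺ p zero    pi≡true rewrite pi≡true = refl
anyF⁺ p (suc i) pi≡true =
  trans (cong (p zero ∨_) (anyF⁺ (p ∘ suc) i pi≡true)) (∨-zeroʳ (p zero))

anyF⁻ : ∀ {n} (p : Fin n → Bool) → anyF p ≡ true → ∃ λ i → p i ≡ true
anyF⁻ {suc n} p any≡true with p zero in p0≡
... | true  = zero , p0≡
... | false with anyF⁻ (p ∘ suc) any≡true
...   | i , pi≡true = suc i , pi≡true

allF⁺ : ∀ {n} (p : Fin n → Bool) → (∀ i → p i ≡ true) → allF p ≡ true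
allF⁺ {zero}  p all-true = refl
allF⁺ {suc n} p all-true rewrite all-true zero = allF⁺ (p ∘ suc) (all-true ∘ suc)

allF⁻ : ∀ {n} (p : Fin n → Bool) → allF p ≡ true → ∀ i → p i ≡ true
allF⁻ {suc n} p all≡true i with p zero in p0≡
allF⁻ {suc n} p all≡true zero    | true = p0≡
allF⁻ {suc n} p all≡true (suc i) | true = allF⁻ (p ∘ suc) all≡true i

module _ {A : Set} {m n : ℕ} (f : Fin (suc m) → A) (g : Fin (suc n) → A) where

  join-↑ˡ : ∀ j → join f g (j ↑ˡ suc n) ≡ f j
  join-↑ˡ j rewrite splitAt-↑ˡ (suc m) j (suc n) = refl

  join-↑ʳ : ∀ j → join f g (suc m ↑ʳ j) ≡ g j
  join-↑ʳ j rewrite splitAt-↑ʳ (suc m) (suc n) j = refl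

  join-cases : ∀ i → (∃ λ j → join f g i ≡ f j) ⊎ (∃ λ j → join f g i ≡ g j)
  join-cases i with splitAt (suc m) i
  ... | inj₁ j = inj₁ (j , refl)
  ... | inj₂ j = inj₂ (j , refl)

  module _ (P : A → Bool) where

    anyF-join⁺ˡ : ∀ j → P (f j) ≡ true → anyF (P ∘ join f g) ≡ true
    anyF-join⁺ˡ j Pfj = anyF⁺ (P ∘ join f g) (j ↑ˡ suc n) (trans (cong P (join-↑ˡ j)) Pfj)

    anyF-join⁺ʳ : ∀ j → P (g j) ≡ true → anyF (P ∘ join f g) ≡ true
    anyF-join⁺ʳ j Pgj = anyF⁺ (P ∘ join f g) (suc m ↑ʳ j) (trans (cong P (join-↑ʳ j)) Pgj)

    anyF-join⁻ : anyF (P ∘ join f g) ≡ true →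
                 (∃ λ j → P (f j) ≡ true) ⊎ (∃ λ j → P (g j) ≡ true)
    anyF-join⁻ any≡true with anyF⁻ (P ∘ join f g) any≡true
    ... | i , Pi with join-cases i
    ...   | inj₁ (j , i↦fj) = inj₁ (j , trans (cong P (sym i↦fj)) Pi)
    ...   | inj₂ (j , i↦gj) = inj₂ (j , trans (cong P (sym i↦gj)) Pi)

    allF-join⁺ : (∀ j → P (f j) ≡ true) → (∀ j → P (g j) ≡ true) →
                 allF (P ∘ join f g) ≡ true
    allF-join⁺ all-f all-g = allF⁺ (P ∘ join f g) λ i → case join-cases i of λ where
      (inj₁ (j , i↦fj)) → trans (cong P i↦fj) (all-f j)
      (inj₂ (j , i↦gj)) → trans (cong P i↦gj) (all-g j)

    allF-join⁻ˡ : allF (P ∘ join f g) ≡ true → ∀ j → P (f j) ≡ true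
    allF-join⁻ˡ all≡true j =
      trans (cong P (sym (join-↑ˡ j))) (allF⁻ (P ∘ join f g) all≡true (j ↑ˡ suc n))

    allF-join⁻ʳ : allF (P ∘ join f g) ≡ true → ∀ j → P (g j) ≡ true
    allF-join⁻ʳ all≡true j =
      trans (cong P (sym (join-↑ʳ j))) (allF⁻ (P ∘ join f g) all≡true (suc m ↑ʳ j))

⊕-leftSecond : ∀ G X → leftSecond G ≡ true → leftSecond X ≡ true → leftSecond (G ⊕ X) ≡ true
⊕-leftFirstˡ : ∀ G X → leftFirst G ≡ true → leftSecond X ≡ true → leftFirst (G ⊕ X) ≡ true
⊕-leftFirstʳ : ∀ G X → leftSecond G ≡ true → leftFirst X ≡ true → leftFirst (G ⊕ X) ≡ true

⊕-leftSecond ∞                X                _  _  = refl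
⊕-leftSecond (node _ _ _ _)   ∞                _  _  = refl
⊕-leftSecond G@(node _ _ _ h) X@(node _ _ _ l) G₂ X₂ =
  allF-join⁺ (λ i → h i ⊕ X) (λ j → G ⊕ l j) leftFirst
    (λ i → ⊕-leftFirstˡ (h i) X (allF⁻ (leftFirst ∘ h) G₂ i) X₂)
    (λ j → ⊕-leftFirstʳ G (l j) G₂ (allF⁻ (leftFirst ∘ l) X₂ j))

⊕-leftFirstˡ ∞                X                _  _  = refl
⊕-leftFirstˡ (node _ _ _ _)   ∞                _  _  = refl
⊕-leftFirstˡ G@(node _ f _ _) X@(node _ k _ _) G₁ X₂ =
  let i , fi₂ = anyF⁻ (leftSecond ∘ f) G₁
  in  anyF-join⁺ˡ (λ i → f i ⊕ X) (λ j → G ⊕ k j) leftSecond i (⊕-leftSecond (f i) X fi₂ X₂)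

⊕-leftFirstʳ ∞                X                _  _  = refl
⊕-leftFirstʳ (node _ _ _ _)   ∞                _  _  = refl
⊕-leftFirstʳ G@(node _ f _ _) X@(node _ k _ _) G₂ X₁ =
  let j , kj₂ = anyF⁻ (leftSecond ∘ k) X₁
  in  anyF-join⁺ʳ (λ i → f i ⊕ X) (λ j → G ⊕ k j) leftSecond j (⊕-leftSecond G (k j) G₂ kj₂)

leftSecond-⊕zero⁻ : ∀ G → leftSecond (G ⊕ zeroF) ≡ true → leftSecond G ≡ true
leftFirst-⊕zero⁻  : ∀ G → leftFirst (G ⊕ zeroF) ≡ true → leftFirst G ≡ true

leftSecond-⊕zero⁻ ∞                G0₂ = G0₂
leftSecond-⊕zero⁻ ∞bar             G0₂ = G0₂
leftSecond-⊕zero⁻ G@(node _ _ _ h) G0₂ = allF⁺ (leftFirst ∘ h) λ i →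
  leftFirst-⊕zero⁻ (h i) (allF-join⁻ˡ (λ i → h i ⊕ zeroF) (λ _ → G ⊕ ∞) leftFirst G0₂ i)

leftFirst-⊕zero⁻ ∞                G0₁ = G0₁
leftFirst-⊕zero⁻ ∞bar             G0₁ = G0₁
leftFirst-⊕zero⁻ G@(node _ f _ _) G0₁
  with anyF-join⁻ (λ i → f i ⊕ zeroF) (λ _ → G ⊕ ∞bar) leftSecond G0₁
... | inj₁ (i , fi0₂) = anyF⁺ (leftSecond ∘ f) i (leftSecond-⊕zero⁻ (f i) fi0₂)
... | inj₂ (_ , ())

leftSecond-zero⊕⁻ : ∀ X → leftSecond (zeroF ⊕ X) ≡ true → leftSecond X ≡ true
leftFirst-zero⊕⁻  : ∀ X → leftFirst (zeroF ⊕ X) ≡ true → leftFirst X ≡ true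

leftSecond-zero⊕⁻ ∞                0X₂ = 0X₂
leftSecond-zero⊕⁻ ∞bar             0X₂ = 0X₂
leftSecond-zero⊕⁻ X@(node _ _ _ l) 0X₂ = allF⁺ (leftFirst ∘ l) λ j →
  leftFirst-zero⊕⁻ (l j) (allF-join⁻ʳ {m = 0} (λ _ → ∞ ⊕ X) (λ j → zeroF ⊕ l j) leftFirst 0X₂ j)

leftFirst-zero⊕⁻ ∞                0X₁ = 0X₁
leftFirst-zero⊕⁻ ∞bar             0X₁ = 0X₁
leftFirst-zero⊕⁻ X@(node _ k _ _) 0X₁
  with anyF-join⁻ {m = 0} (λ _ → ∞bar ⊕ X) (λ j → zeroF ⊕ k j) leftSecond 0X₁
... | inj₁ (_ , ())
... | inj₂ (j , 0kj₂) = anyF⁺ (leftSecond ∘ k) j (leftSecond-zero⊕⁻ (k j) 0kj₂)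

o-mono : ∀ G H → (leftFirst H ≡ true → leftFirst G ≡ true) →
         (leftSecond H ≡ true → leftSecond G ≡ true) → o G ≥ₒ o H
o-mono G H lf ls with leftFirst G | leftSecond G | leftFirst H | leftSecond H
... | true  | true  | true  | true  = refl≥
... | true  | true  | true  | false = L≥N
... | true  | true  | false | true  = L≥P
... | true  | true  | false | false = L≥R
... | true  | false | true  | false = refl≥
... | true  | false | false | false = N≥R
... | false | true  | false | true  = refl≥
... | false | true  | false | false = P≥R
... | false | false | false | false = refl≥
... | _     | false | _     | true  = case ls refl of λ ()
... | false | _     | true  | _     = case lf refl of λ ()

o∈𝓛𝓟⇒leftSecond : ∀ G → o G ≡ 𝓛 ⊎ o G ≡ 𝓟 → leftSecond G ≡ true
o∈𝓛𝓟⇒leftSecond G o∈𝓛𝓟 with leftFirst G | leftSecond G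
... | _     | true  = refl
... | true  | false = case o∈𝓛𝓟 of λ { (inj₁ ()) ; (inj₂ ()) }
... | false | false = case o∈𝓛𝓟 of λ { (inj₁ ()) ; (inj₂ ()) }

leftSecond⇒o∈𝓛𝓟 : ∀ G → leftSecond G ≡ true → o G ≡ 𝓛 ⊎ o G ≡ 𝓟
leftSecond⇒o∈𝓛𝓟 G G₂ with leftFirst G | leftSecond G
... | true  | true = inj₁ refl
... | false | true = inj₂ refl

≥ₒ𝓟⇒∈𝓛𝓟 : ∀ {x} → x ≥ₒ 𝓟 → x ≡ 𝓛 ⊎ x ≡ 𝓟
≥ₒ𝓟⇒∈𝓛𝓟 refl≥ = inj₂ refl
≥ₒ𝓟⇒∈𝓛𝓟 L≥P   = inj₁ refl

≽zero⇒leftSecond : ∀ G → G ≽ zeroF → leftSecond G ≡ true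
≽zero⇒leftSecond G G≽0 = leftSecond-⊕zero⁻ G
  (o∈𝓛𝓟⇒leftSecond (G ⊕ zeroF) (≥ₒ𝓟⇒∈𝓛𝓟 (G≽0 0 (λ _ → ∞bar) 0 (λ _ → ∞))))

leftSecond⇒≽zero : ∀ G → leftSecond G ≡ true → G ≽ zeroF
leftSecond⇒≽zero G G₂ m f n h = o-mono (G ⊕ X) (zeroF ⊕ X)
  (λ 0X₁ → ⊕-leftFirstʳ G X G₂ (leftFirst-zero⊕⁻ X 0X₁))
  (λ 0X₂ → ⊕-leftSecond G X G₂ (leftSecond-zero⊕⁻ X 0X₂))
  where X = node m f n h

theorem2p8 : (G : Form) → ((G ≽ zeroF) → (o G ≡ 𝓛 ⊎ o G ≡ 𝓟)) × ((o G ≡ 𝓛 ⊎ o G ≡ 𝓟) → (G ≽ zeroF))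
theorem2p8 G =
  (λ G≽0 → leftSecond⇒o∈𝓛𝓟 G (≽zero⇒leftSecond G G≽0)) ,
  (λ o∈𝓛𝓟 → leftSecond⇒≽zero G (o∈𝓛𝓟⇒leftSecond G o∈𝓛𝓟))
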